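{- Let $i\ge 0$ and $n\in\{i,i+1,i+2\}$. Then player $B$ has a winning strategy for chomp on $\mathcal{K}_n^i$ when $i\equiv n\equiv 2 \pmod 3$, and when $i\equiv n-1\equiv 0\pmod 3$; otherwise player $B$ loses (i.e., player $A$ has a winning strategy).
   Context: Chomp on a finite graph: two players, $A$ moving first and then $B$, alternately remove either an edge or a vertex together with all its incident edges; the player who cannot move (the graph is empty) loses. For integers $n\ge 0$ and $0\le i_1,\dots,i_k\le n$, the graph $\mathcal{K}_n^{i_1,\dots,i_k}$ consists of a complete graph on vertices $u_1,\dots,u_n$ together with $k$ further vertices $v_{i_1},\dots,v_{i_k}$, where $v_{i_j}$ is adjacent exactly to $u_1,\dots,u_{i_j}$. -}

module Defs where

open import Data.Nat using (ℕ; zero; suc; _<ᵇ_)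
open import Data.Fin using (Fin; toℕ; fromℕ)
open import Data.Fin.Properties using (_≟_)
open import Data.Bool using (Bool; true; false; _∧_; _∨_; not; T)
open import Relation.Nullary using (does)

-- A finite simple graph whose vertices are among Fin N.
-- vert x : x is (still) a vertex; edge a b : {a,b} is an edge (symmetric,
-- irreflexive, and only between present vertices for all graphs built here).
record Graph (N : ℕ) : Set where
  constructor mkGraph
  field
    vert : Fin N → Bool
    edge : Fin N → Fin N → Bool
open Graph public

_==_ : ∀ {N} → Fin N → Fin N → Bool
a == b = does (a ≟ b)

removeEdge : ∀ {N} → Graph N → Fin N → Fin N → Graph N
removeEdge G u v = mkGraph (vert G)
  (λ a b → edge G a b ∧ not ((a == u ∧ b == v) ∨ (a == v ∧ b == u)))

removeVertex : ∀ {N} → Graph N → Fin N → Graph N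
removeVertex G v = mkGraph (λ w → vert G w ∧ not (w == v))
  (λ a b → edge G a b ∧ not (a == v) ∧ not (b == v))

data Move {N : ℕ} (G : Graph N) : Set where
  delEdge   : (u v : Fin N) → T (edge G u v) → Move G
  delVertex : (v : Fin N) → T (vert G v) → Move G

play : ∀ {N} (G : Graph N) → Move G → Graph N
play G (delEdge u v _) = removeEdge G u v
play G (delVertex v _) = removeVertex G v

-- Lose G : the player to move from G loses (the opponent has a winning strategy);
--          in particular a position with no moves (empty graph) is losing.
data Win  {N : ℕ} (G : Graph N) : Set
data Lose {N : ℕ} (G : Graph N) : Set

data Win G where
  win : (m : Move G) → Lose (play G m) → Win G

data Lose G where
  lose : ((m : Move G) → Win (play G m)) → Lose G

-- K_n^i : complete graph on u_1..u_n (Fin indices 0..n-1) plus a vertex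
-- v_i (Fin index n) adjacent exactly to u_1..u_i (Fin indices 0..i-1).
K : (n i : ℕ) → Graph (suc n)
K n i = mkGraph (λ _ → true) adj
  where
    isU : Fin (suc n) → Bool
    isU a = toℕ a <ᵇ n
    isV : Fin (suc n) → Bool
    isV a = a == fromℕ n
    nbrV : Fin (suc n) → Bool
    nbrV a = toℕ a <ᵇ i
    adj : Fin (suc n) → Fin (suc n) → Bool
    adj a b = (isU a ∧ isU b ∧ not (a == b))
            ∨ (isV a ∧ nbrV b) ∨ (isV b ∧ nbrV a)

-- Chomp on a clique with r vertices is lost by the player to move iff 3 ∣ r. Deleting a
-- vertex leaves a clique on r − 1 vertices. Deleting an edge st leaves a graph with the
-- outcome of the clique on r − 2 vertices: the transposition of s and t is an automorphism
-- of it, and the second player answers every move touching s or t by its mirror image, so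
-- only the play on the other r − 2 vertices matters.
-- Now K_i^i is a clique on i + 1 vertices, K_{i+1}^i is a clique on i + 2 vertices minus the
-- edge v_i u_{i+1}, and K_{i+2}^i is a clique on i + 3 vertices minus the edges v_i u_{i+1}
-- and v_i u_{i+2}. In the last one the first player wins by deleting u_{i+2}, v_i or the
-- edge u_{i+1} u_{i+2} according as i ≡ 0, 1, 2 (mod 3); each of these moves leaves a
-- position with the outcome of a clique on a multiple of 3 vertices (the third by mirroring
-- u_{i+1} and u_{i+2}).

module Submission where

open import Defs
open import Algebra.Bundles using (CommutativeMonoid)
open import Data.Bool using (Bool; true; false; _∧_; _∨_; not; T)
open import Data.Bool.Properties
  using (∧-assoc; ∧-comm; ∧-zeroʳ; ∧-identityʳ; ∨-comm; ∨-identityʳ; ∧-commutativeMonoid)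
open import Data.Bool.Properties using (T-∧; T-≡; T-not-≡)
open import Data.Empty using (⊥; ⊥-elim)
open import Data.Fin using (Fin; zero; suc; toℕ; fromℕ; fromℕ<)
open import Data.Fin.Permutation.Components using (transpose)
open import Data.Fin.Properties using (_≟_; toℕ-fromℕ; toℕ-fromℕ<)
open import Data.Nat using (ℕ; zero; suc; _+_; _%_; _<_; _≤_; _<ᵇ_; _≡ᵇ_; z≤n; s≤s)
import Data.Nat as ℕ
open import Data.Nat.Induction using (<-wellFounded)
open import Data.Nat.Properties
  using (≤-refl; <-trans; <⇒≢; n<1+n; m<n⇒m<1+n; +-suc; suc-injective)
open import Data.Nat.Properties using (+-mono-≤; +-mono-<-≤; +-mono-≤-<)
open import Data.Product using (_×_; _,_; proj₁; proj₂; ∃-syntax)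
open import Data.Sum using (_⊎_; inj₁; inj₂; [_,_])
import Data.Sum
open import Data.Unit using (tt)
open import Function using (_∘_)
open import Function.Bundles using (Equivalence)
open Equivalence using (to; from)
open import Induction.WellFounded using (WellFounded; Acc; acc)
open import Level using (0ℓ)
open import Relation.Binary using (Rel; Setoid)
import Relation.Binary.Construct.On as On
import Relation.Binary.Reasoning.Setoid as SetoidReasoning
open import Relation.Binary.PropositionalEquality
  using (_≡_; _≢_; refl; sym; trans; cong; cong₂; subst; ≢-sym; module ≡-Reasoning)
open import Relation.Nullary using (¬_; Dec; does; yes; no)
open import Relation.Nullary.Decidable using (dec-true; dec-false; _×-dec_; _⊎-dec_)
open import Algebra.Properties.CommutativeSemigroup
  (CommutativeMonoid.commutativeSemigroup ∧-commutativeMonoid) using (interchange; xy∙z≈xz∙y)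

private variable
  N : ℕ
  G H : Graph N
  P Q : Fin N → Bool
  s t u v x y : Fin N
  n i : ℕ

true≢false : true ≢ false
true≢false ()

==-refl : (a : Fin N) → (a == a) ≡ true
==-refl a = dec-true (a ≟ a) refl

==-sym : (a b : Fin N) → (a == b) ≡ (b == a)
==-sym a b with a ≟ b | b ≟ a
... | yes _   | yes _   = refl
... | no _    | no _    = refl
... | yes a≡b | no b≢a  = ⊥-elim (b≢a (sym a≡b))
... | no a≢b  | yes b≡a = ⊥-elim (a≢b (sym b≡a))

==⇒≡ : {a b : Fin N} → T (a == b) → a ≡ b
==⇒≡ {a = a} {b} t with a ≟ b
... | yes a≡b = a≡b

-- edge (removeEdge G u v) a b is definitionally edge G a b ∧ not (joins u v a b).
joins : Fin N → Fin N → Fin N → Fin N → Bool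
joins u v a b = (a == u ∧ b == v) ∨ (a == v ∧ b == u)

joins-endpoints : ∀ {a b : Fin N} → T (joins u v a b) → (a ≡ u × b ≡ v) ⊎ (a ≡ v × b ≡ u)
joins-endpoints {u = u} {v} {a} {b} j with a ≟ u | b ≟ v | a ≟ v | b ≟ u
... | yes a≡u | yes b≡v | _       | _       = inj₁ (a≡u , b≡v)
... | _       | _       | yes a≡v | yes b≡u = inj₂ (a≡v , b≡u)
... | yes _   | no _    | yes _   | no _    = ⊥-elim j
... | yes _   | no _    | no _    | _       = ⊥-elim j
... | no _    | _       | yes _   | no _    = ⊥-elim j
... | no _    | _       | no _    | _       = ⊥-elim j

infix 4 _≈_
record _≈_ (G H : Graph N) : Set where
  constructor mk≈
  field
    vert≈ : ∀ x → vert G x ≡ vert H x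
    edge≈ : ∀ x y → edge G x y ≡ edge H x y
open _≈_ public

≈-refl : G ≈ G
≈-refl = mk≈ (λ _ → refl) (λ _ _ → refl)

≈-sym : G ≈ H → H ≈ G
≈-sym G≈H = mk≈ (λ x → sym (vert≈ G≈H x)) (λ x y → sym (edge≈ G≈H x y))

≈-trans : {J : Graph N} → G ≈ H → H ≈ J → G ≈ J
≈-trans G≈H H≈J = mk≈ (λ x → trans (vert≈ G≈H x) (vert≈ H≈J x))
                      (λ x y → trans (edge≈ G≈H x y) (edge≈ H≈J x y))

≈-setoid : ℕ → Setoid 0ℓ 0ℓ
≈-setoid N = record
  { Carrier       = Graph N
  ; _≈_           = _≈_
  ; isEquivalence = record { refl = ≈-refl ; sym = ≈-sym ; trans = ≈-trans }
  }

module ≈-Reasoning {N} = SetoidReasoning (≈-setoid N)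

-- removeVertex G v is definitionally G ↾ (λ x → not (x == v)).
infixl 5 _↾_
_↾_ : Graph N → (Fin N → Bool) → Graph N
G ↾ P = mkGraph (λ x → vert G x ∧ P x) (λ x y → edge G x y ∧ P x ∧ P y)

↾-cong : G ≈ H → (∀ x → P x ≡ Q x) → G ↾ P ≈ H ↾ Q
↾-cong G≈H P≗Q = mk≈ (λ x → cong₂ _∧_ (vert≈ G≈H x) (P≗Q x))
                     (λ x y → cong₂ _∧_ (edge≈ G≈H x y) (cong₂ _∧_ (P≗Q x) (P≗Q y)))

removeVertex-cong : G ≈ H → u ≡ v → removeVertex G u ≈ removeVertex H v
removeVertex-cong G≈H refl = ↾-cong G≈H (λ _ → refl)

removeEdge-cong : {u′ v′ : Fin N} → G ≈ H → u ≡ u′ → v ≡ v′ →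
                  removeEdge G u v ≈ removeEdge H u′ v′
removeEdge-cong G≈H refl refl = mk≈ (vert≈ G≈H) (λ x y → cong (_∧ _) (edge≈ G≈H x y))

transport : G ≈ H → Move G → Move H
transport G≈H (delEdge u v e)   = delEdge u v (subst T (edge≈ G≈H u v) e)
transport G≈H (delVertex v p)   = delVertex v (subst T (vert≈ G≈H v) p)

play-transport : (G≈H : G ≈ H) (m : Move G) → play G m ≈ play H (transport G≈H m)
play-transport G≈H (delEdge _ _ _) = removeEdge-cong G≈H refl refl
play-transport G≈H (delVertex _ _) = removeVertex-cong G≈H refl

Win-resp-≈  : G ≈ H → Win G → Win H
Lose-resp-≈ : G ≈ H → Lose G → Lose H
Win-resp-≈ G≈H (win m l) = win (transport G≈H m) (Lose-resp-≈ (play-transport G≈H m) l)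
Lose-resp-≈ G≈H (lose f) = lose λ m →
  Win-resp-≈ (≈-sym (play-transport (≈-sym G≈H) m)) (f (transport (≈-sym G≈H) m))

Outcome : ℕ → Graph N → Set
Outcome zero    G = Lose G
Outcome (suc _) G = Win G

Outcome-≡ : ∀ (G : Graph N) {j k} → j ≡ k → Outcome j G → Outcome k G
Outcome-≡ G j≡k = subst (λ k → Outcome k G) j≡k

infix 4 _▷_
_▷_ : Graph N → Graph N → Set
G ▷ H = (Lose G → Lose H) × (Win G → Win H)

≈⇒▷ : G ≈ H → G ▷ H
≈⇒▷ G≈H = Lose-resp-≈ G≈H , Win-resp-≈ G≈H

▷-trans : {J : Graph N} → G ▷ H → H ▷ J → G ▷ J
▷-trans (l₁ , w₁) (l₂ , w₂) = l₂ ∘ l₁ , w₂ ∘ w₁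

▷-Outcome : G ▷ H → ∀ k → Outcome k G → Outcome k H
▷-Outcome G▷H zero    = proj₁ G▷H
▷-Outcome G▷H (suc _) = proj₂ G▷H

sum : (Fin N → ℕ) → ℕ
sum {zero}  f = 0
sum {suc N} f = f zero + sum (f ∘ suc)

sum-mono-≤ : {f g : Fin N → ℕ} → (∀ x → f x ≤ g x) → sum f ≤ sum g
sum-mono-≤ {zero}  f≤g = z≤n
sum-mono-≤ {suc N} f≤g = +-mono-≤ (f≤g zero) (sum-mono-≤ (f≤g ∘ suc))

sum-mono-< : {f g : Fin N → ℕ} → (∀ x → f x ≤ g x) → ∀ x → f x < g x → sum f < sum g
sum-mono-< f≤g zero    fx<gx = +-mono-<-≤ fx<gx (sum-mono-≤ (f≤g ∘ suc))
sum-mono-< f≤g (suc x) fx<gx = +-mono-≤-< (f≤g zero) (sum-mono-< (f≤g ∘ suc) x fx<gx)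

bit : Bool → ℕ
bit true  = 1
bit false = 0

count : (Fin N → Bool) → ℕ
count P = sum (bit ∘ P)

bit-∧-≤ : ∀ a b → bit (a ∧ b) ≤ bit a
bit-∧-≤ true  true  = ≤-refl
bit-∧-≤ true  false = z≤n
bit-∧-≤ false _     = z≤n

count-∧-≤ : (P R : Fin N → Bool) → count (λ x → P x ∧ R x) ≤ count P
count-∧-≤ P R = sum-mono-≤ (λ x → bit-∧-≤ (P x) (R x))

count-∧-< : (P R : Fin N → Bool) → T (P x) → R x ≡ false → count (λ x → P x ∧ R x) < count P
count-∧-< {x = x} P R Px Rx≡false =
  sum-mono-< (λ y → bit-∧-≤ (P y) (R y)) x (lemma (P x) Px Rx≡false)
  where
  lemma : ∀ a → T a → R x ≡ false → bit (a ∧ R x) < bit a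
  lemma true _ eq rewrite eq = s≤s z≤n

count-true : ∀ N → count {N} (λ _ → true) ≡ N
count-true zero    = refl
count-true (suc N) = cong suc (count-true N)

count-cong : {Q : Fin N → Bool} → (∀ x → P x ≡ Q x) → count P ≡ count Q
count-cong {N = zero}  P≗Q = refl
count-cong {N = suc N} P≗Q = cong₂ _+_ (cong bit (P≗Q zero)) (count-cong (P≗Q ∘ suc))

count-remove : (P : Fin N → Bool) → T (P x) → count P ≡ suc (count (λ z → P z ∧ not (z == x)))
count-remove {N = suc N} {x = zero} P p with P zero
... | true = cong suc (count-cong (λ z → sym (∧-identityʳ (P (suc z)))))
count-remove {N = suc N} {x = suc x} P p = begin
  bit (P zero) + count (P ∘ suc)
    ≡⟨ cong (bit (P zero) +_) (count-remove (P ∘ suc) p) ⟩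
  bit (P zero) + suc (count (λ z → P (suc z) ∧ not (z == x)))
    ≡⟨ +-suc (bit (P zero)) _ ⟩
  suc (bit (P zero) + count (λ z → P (suc z) ∧ not (z == x)))
    ≡⟨ cong (λ b → suc (bit b + count (λ z → P (suc z) ∧ not (z == x)))) (sym (∧-identityʳ (P zero))) ⟩
  suc (bit (P zero ∧ true) + count (λ z → P (suc z) ∧ not (z == x))) ∎
  where open ≡-Reasoning

count-witness : {P : Fin N → Bool} {n : ℕ} → count P ≡ suc n → ∃[ x ] T (P x)
count-witness {N = suc N} {P = P} eq with P zero in P0
... | true  = zero , subst T (sym P0) tt
... | false with count-witness {P = P ∘ suc} eq
...   | x , p = suc x , p

count-zero : {P : Fin N → Bool} {x : Fin N} → count P ≡ 0 → ¬ T (P x)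
count-zero {N = suc N} {P = P} {x = x} eq p with P zero in P0
count-zero {N = suc N} {P = P} {x = zero}  eq p | false = subst T P0 p
count-zero {N = suc N} {P = P} {x = suc x} eq p | false = count-zero {P = P ∘ suc} eq p

size : Graph N → ℕ
size G = count (vert G) + sum (count ∘ edge G)

_⊏_ : Rel (Graph N) 0ℓ
G ⊏ H = size G < size H

⊏-wellFounded : WellFounded (_⊏_ {N})
⊏-wellFounded = On.wellFounded size <-wellFounded

play-⊏ : (m : Move G) → play G m ⊏ G
play-⊏ {G = G} (delVertex v p) =
  +-mono-<-≤ (count-∧-< (vert G) (λ x → not (x == v)) p (cong not (==-refl v)))
             (sum-mono-≤ λ a → count-∧-≤ (edge G a) (λ b → not (a == v) ∧ not (b == v)))
play-⊏ {G = G} (delEdge u v e) =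
  +-mono-≤-< ≤-refl
    (sum-mono-< (λ a → count-∧-≤ (edge G a) (λ b → not (joins u v a b))) u
                (count-∧-< (edge G u) (λ b → not (joins u v u b)) e
                           (cong (λ b → not (b ∨ ((u == v) ∧ (v == u))))
                                 (cong₂ _∧_ (==-refl u) (==-refl v)))))

removeEdge-removes : ¬ T (edge (removeEdge G u v) u v)
removeEdge-removes {G = G} {u = u} {v} e rewrite ==-refl u | ==-refl v =
  proj₂ (to (T-∧ {edge G u v}) e)

↾-↾ : G ↾ P ↾ Q ≈ G ↾ (λ x → P x ∧ Q x)
↾-↾ {G = G} {P = P} {Q} = mk≈
  (λ x → ∧-assoc (vert G x) (P x) (Q x))
  (λ a b → trans (∧-assoc (edge G a b) (P a ∧ P b) (Q a ∧ Q b))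
                 (cong (edge G a b ∧_) (interchange (P a) (P b) (Q a) (Q b))))

↾-comm : G ↾ P ↾ Q ≈ G ↾ Q ↾ P
↾-comm {G = G} {P = P} {Q} =
  ≈-trans (↾-↾ {G = G})
          (≈-trans (↾-cong (≈-refl {G = G}) (λ x → ∧-comm (P x) (Q x))) (≈-sym (↾-↾ {G = G})))

↾-removeEdge : removeEdge G u v ↾ P ≈ removeEdge (G ↾ P) u v
↾-removeEdge {G = G} {u = u} {v} {P} =
  mk≈ (λ _ → refl) (λ a b → xy∙z≈xz∙y (edge G a b) (not (joins u v a b)) (P a ∧ P b))

removeEdge-sym : removeEdge G u v ≈ removeEdge G v u
removeEdge-sym {G = G} {u = u} {v} =
  mk≈ (λ _ → refl) λ a b →
    cong (λ j → edge G a b ∧ not j) (∨-comm (a == u ∧ b == v) (a == v ∧ b == u))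

removeEdge-comm : removeEdge (removeEdge G u v) x y ≈ removeEdge (removeEdge G x y) u v
removeEdge-comm {G = G} {u = u} {v} {x} {y} =
  mk≈ (λ _ → refl) (λ a b → xy∙z≈xz∙y (edge G a b) (not (joins u v a b)) (not (joins x y a b)))

removeVertex-↾-outside : P v ≡ false → removeVertex G v ↾ P ≈ G ↾ P
removeVertex-↾-outside {P = P} {v = v} {G = G} Pv≡false =
  ≈-trans (↾-↾ {G = G}) (↾-cong (≈-refl {G = G}) absorb)
  where
  absorb : ∀ x → not (x == v) ∧ P x ≡ P x
  absorb x with x ≟ v
  ... | yes refl = sym Pv≡false
  ... | no _     = refl

removeEdge-↾-outside : P u ≡ false ⊎ P v ≡ false → removeEdge G u v ↾ P ≈ G ↾ P
removeEdge-↾-outside {P = P} {u = u} {v} {G = G} outside = mk≈ (λ _ → refl) λ a b →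
  begin
    (edge G a b ∧ not (joins u v a b)) ∧ P a ∧ P b ≡⟨ xy∙z≈xz∙y (edge G a b) _ _ ⟩
    (edge G a b ∧ P a ∧ P b) ∧ not (joins u v a b) ≡⟨ ∧-assoc (edge G a b) _ _ ⟩
    edge G a b ∧ (P a ∧ P b) ∧ not (joins u v a b) ≡⟨ cong (edge G a b ∧_) (absorb a b) ⟩
    edge G a b ∧ P a ∧ P b                         ∎
  where
  open ≡-Reasoning
  endpoint-inside : ∀ {a b} → P a ≡ true → P b ≡ true →
                    (a ≡ u × b ≡ v) ⊎ (a ≡ v × b ≡ u) → ¬ (P u ≡ false ⊎ P v ≡ false)
  endpoint-inside Pa Pb (inj₁ (refl , _)) (inj₁ Pu) = true≢false (trans (sym Pa) Pu)
  endpoint-inside Pa Pb (inj₁ (_ , refl)) (inj₂ Pv) = true≢false (trans (sym Pb) Pv)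
  endpoint-inside Pa Pb (inj₂ (_ , refl)) (inj₁ Pu) = true≢false (trans (sym Pb) Pu)
  endpoint-inside Pa Pb (inj₂ (refl , _)) (inj₂ Pv) = true≢false (trans (sym Pa) Pv)

  absorb : ∀ a b → (P a ∧ P b) ∧ not (joins u v a b) ≡ P a ∧ P b
  absorb a b with P a in Pa | P b in Pb | joins u v a b in j
  ... | false | _     | _     = refl
  ... | true  | false | _     = refl
  ... | true  | true  | false = refl
  ... | true  | true  | true  =
    ⊥-elim (endpoint-inside Pa Pb (joins-endpoints {u = u} {v} {a} {b} (subst T (sym j) tt)) outside)

complete : ∀ N → Graph N
complete N = mkGraph (λ _ → true) (λ a b → not (a == b))

edge-removeVertex : ∀ {a b} → T (edge (removeVertex G v) a b) → T (edge G a b)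
edge-removeVertex {G = G} {a = a} {b} = proj₁ ∘ to (T-∧ {edge G a b})

edge-removeEdge : ∀ {a b} → T (edge (removeEdge G u v) a b) → T (edge G a b)
edge-removeEdge {G = G} {a = a} {b} = proj₁ ∘ to (T-∧ {edge G a b})

-- The mirror strategy

relabel : (Fin N → Fin N) → Graph N → Graph N
relabel σ G = mkGraph (vert G ∘ σ) (λ a b → edge G (σ a) (σ b))

module Mirror {N} (σ : Fin N → Fin N) (σ-involutive : ∀ x → σ (σ x) ≡ x) where

  σ==-flip : ∀ a b → (σ a == b) ≡ (a == σ b)
  σ==-flip a b with σ a ≟ b | a ≟ σ b
  ... | yes _    | yes _    = refl
  ... | no _     | no _     = refl
  ... | yes σa≡b | no a≢σb  = ⊥-elim (a≢σb (trans (sym (σ-involutive a)) (cong σ σa≡b)))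
  ... | no σa≢b  | yes a≡σb = ⊥-elim (σa≢b (trans (cong σ a≡σb) (σ-involutive b)))

  σ==σ : ∀ a b → (σ a == σ b) ≡ (a == b)
  σ==σ a b = trans (σ==-flip a (σ b)) (cong (a ==_) (σ-involutive b))

  relabel-complete : relabel σ (complete N) ≈ complete N
  relabel-complete = mk≈ (λ _ → refl) (λ a b → cong not (σ==σ a b))

  relabel-removeVertex : relabel σ (removeVertex G v) ≈ removeVertex (relabel σ G) (σ v)
  relabel-removeVertex {G = G} {v = v} = ↾-cong (≈-refl {G = relabel σ G}) (λ a → cong not (σ==-flip a v))

  relabel-removeEdge : relabel σ (removeEdge G u v) ≈ removeEdge (relabel σ G) (σ u) (σ v)
  relabel-removeEdge {G = G} {u = u} {v} = mk≈ (λ _ → refl) λ a b →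
    cong (λ j → edge G (σ a) (σ b) ∧ not j)
         (cong₂ _∨_ (cong₂ _∧_ (σ==-flip a u) (σ==-flip b v)) (cong₂ _∧_ (σ==-flip a v) (σ==-flip b u)))

  fixed : Fin N → Bool
  fixed x = σ x == x

  record Symmetric (G : Graph N) : Set where
    field
      invariant      : relabel σ G ≈ G
      -- ensures that the mirror image of an edge move is another edge, still present after it
      no-mirror-edge : ∀ x → σ x ≢ x → ¬ T (edge G x (σ x))
  open Symmetric

  fixed⇒≡ : T (fixed x) → σ x ≡ x
  fixed⇒≡ = ==⇒≡

  ≡⇒fixed : σ x ≡ x → T (fixed x)
  ≡⇒fixed {x = x} σx≡x = subst T (sym (dec-true (σ x ≟ x) σx≡x)) tt

  ≢⇒unfixed : σ x ≢ x → fixed x ≡ false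
  ≢⇒unfixed {x = x} = dec-false (σ x ≟ x)

  moved-σ : σ x ≢ x → σ (σ x) ≢ σ x
  moved-σ {x} σx≢x σσx≡σx = σx≢x (trans (sym σσx≡σx) (σ-involutive x))

  symmetric-shrink : Symmetric G → relabel σ H ≈ H →
                     (∀ {a b} → T (edge H a b) → T (edge G a b)) → Symmetric H
  symmetric-shrink S inv H⊆G = record
    { invariant = inv ; no-mirror-edge = λ x σx≢x → no-mirror-edge S x σx≢x ∘ H⊆G }

  symmetric-removeVertex : Symmetric G → σ x ≡ x → Symmetric (removeVertex G x)
  symmetric-removeVertex {G = G} S σx≡x = symmetric-shrink S
    (≈-trans (relabel-removeVertex {G = G}) (removeVertex-cong (invariant S) σx≡x))
    (edge-removeVertex {G = G})

  symmetric-removeEdge : Symmetric G → σ x ≡ x → σ y ≡ y → Symmetric (removeEdge G x y)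
  symmetric-removeEdge {G = G} S σx≡x σy≡y = symmetric-shrink S
    (≈-trans (relabel-removeEdge {G = G}) (removeEdge-cong (invariant S) σx≡x σy≡y))
    (edge-removeEdge {G = G})

  symmetric-removeVertex-pair : Symmetric G → Symmetric (removeVertex (removeVertex G x) (σ x))
  symmetric-removeVertex-pair {G = G} {x = x} S = symmetric-shrink S invariant-pair
    (edge-removeVertex {G = G} ∘ edge-removeVertex {G = removeVertex G x})
    where
    open ≈-Reasoning
    invariant-pair : relabel σ (removeVertex (removeVertex G x) (σ x)) ≈
                     removeVertex (removeVertex G x) (σ x)
    invariant-pair = begin
      relabel σ (removeVertex (removeVertex G x) (σ x))
        ≈⟨ relabel-removeVertex {G = removeVertex G x} ⟩
      removeVertex (relabel σ (removeVertex G x)) (σ (σ x))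
        ≈⟨ removeVertex-cong (relabel-removeVertex {G = G}) (σ-involutive x) ⟩
      removeVertex (removeVertex (relabel σ G) (σ x)) x
        ≈⟨ removeVertex-cong (removeVertex-cong (invariant S) refl) refl ⟩
      removeVertex (removeVertex G (σ x)) x
        ≈⟨ ↾-comm {G = G} ⟩
      removeVertex (removeVertex G x) (σ x) ∎

  symmetric-removeEdge-pair : Symmetric G → Symmetric (removeEdge (removeEdge G x y) (σ x) (σ y))
  symmetric-removeEdge-pair {G = G} {x = x} {y} S = symmetric-shrink S invariant-pair
    (edge-removeEdge {G = G} ∘ edge-removeEdge {G = removeEdge G x y})
    where
    open ≈-Reasoning
    invariant-pair : relabel σ (removeEdge (removeEdge G x y) (σ x) (σ y)) ≈
                     removeEdge (removeEdge G x y) (σ x) (σ y)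
    invariant-pair = begin
      relabel σ (removeEdge (removeEdge G x y) (σ x) (σ y))
        ≈⟨ relabel-removeEdge {G = removeEdge G x y} ⟩
      removeEdge (relabel σ (removeEdge G x y)) (σ (σ x)) (σ (σ y))
        ≈⟨ removeEdge-cong (relabel-removeEdge {G = G}) (σ-involutive x) (σ-involutive y) ⟩
      removeEdge (removeEdge (relabel σ G) (σ x) (σ y)) x y
        ≈⟨ removeEdge-cong (removeEdge-cong (invariant S) refl refl) refl refl ⟩
      removeEdge (removeEdge G (σ x) (σ y)) x y
        ≈⟨ removeEdge-comm {G = G} ⟩
      removeEdge (removeEdge G x y) (σ x) (σ y) ∎

  mirror-vertex : Symmetric G → σ x ≢ x → T (vert G x) → T (vert (removeVertex G x) (σ x))
  mirror-vertex {x = x} S σx≢x p = from T-∧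
    (subst T (sym (vert≈ (invariant S) x)) p , from T-not-≡ (≢⇒unfixed σx≢x))

  mirror-edge : Symmetric G → σ x ≢ x ⊎ σ y ≢ y → T (edge G x y) →
                T (edge (removeEdge G x y) (σ x) (σ y))
  mirror-edge {G = G} {x = x} {y} S moved e = from T-∧
    (subst T (sym (edge≈ (invariant S) x y)) e , from T-not-≡ no-join)
    where
    not-both-fixed : σ x ≡ x → σ y ≡ y → ⊥
    not-both-fixed σx≡x σy≡y = [ (λ σx≢x → σx≢x σx≡x) , (λ σy≢y → σy≢y σy≡y) ] moved
    no-join : joins x y (σ x) (σ y) ≡ false
    no-join with joins x y (σ x) (σ y) in j
    ... | false = refl
    ... | true with joins-endpoints {u = x} {y} {σ x} {σ y} (subst T (sym j) tt)
    ...   | inj₁ (σx≡x , σy≡y) = ⊥-elim (not-both-fixed σx≡x σy≡y)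
    ...   | inj₂ (σx≡y , σy≡x) =
      ⊥-elim (no-mirror-edge S x σx≢x (subst (T ∘ edge G x) (sym σx≡y) e))
      where
      σx≢x : σ x ≢ x
      σx≢x σx≡x = not-both-fixed σx≡x (trans σy≡x (trans (sym σx≡x) σx≡y))

  -- A move touching a vertex not fixed by σ is answered by its mirror image, which restores
  -- the symmetry and does not change G ↾ fixed; other moves are answered as in G ↾ fixed.
  mirror-lose : Acc _⊏_ G → Symmetric G → Lose (G ↾ fixed) → Lose G
  mirror-win  : Acc _⊏_ G → Symmetric G → Win (G ↾ fixed) → Win G

  mirror-win {G = G} (acc rs) S (win (delVertex x p) l) with to (T-∧ {vert G x}) p
  ... | p₁ , fx = win (delVertex x p₁)
    (mirror-lose (rs (play-⊏ (delVertex x p₁))) (symmetric-removeVertex S (fixed⇒≡ fx))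
                 (Lose-resp-≈ (↾-comm {G = G}) l))
  mirror-win {G = G} (acc rs) S (win (delEdge x y e) l) with to (T-∧ {edge G x y}) e
  ... | e₁ , fxy with to (T-∧ {fixed x}) fxy
  ...   | fx , fy = win (delEdge x y e₁)
    (mirror-lose (rs (play-⊏ (delEdge x y e₁))) (symmetric-removeEdge S (fixed⇒≡ fx) (fixed⇒≡ fy))
                 (Lose-resp-≈ (≈-sym (↾-removeEdge {G = G})) l))

  mirror-lose {G = G} (acc rs) S (lose f) = lose reply
    where
    reply-moved-vertex : (p : T (vert G x)) → σ x ≢ x → Win (removeVertex G x)
    reply-moved-vertex {x = x} p σx≢x = win (delVertex (σ x) q)
      (mirror-lose (rs (<-trans (play-⊏ (delVertex (σ x) q)) (play-⊏ (delVertex x p))))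
                   (symmetric-removeVertex-pair S)
                   (Lose-resp-≈ (≈-sym core) (lose f)))
      where
      q : T (vert (removeVertex G x) (σ x))
      q = mirror-vertex S σx≢x p
      core : removeVertex (removeVertex G x) (σ x) ↾ fixed ≈ G ↾ fixed
      core = ≈-trans (removeVertex-↾-outside {G = removeVertex G x} (≢⇒unfixed (moved-σ σx≢x)))
                     (removeVertex-↾-outside {G = G} (≢⇒unfixed σx≢x))

    reply-moved-edge : (e : T (edge G x y)) → σ x ≢ x ⊎ σ y ≢ y → Win (removeEdge G x y)
    reply-moved-edge {x = x} {y} e moved = win (delEdge (σ x) (σ y) q)
      (mirror-lose (rs (<-trans (play-⊏ (delEdge (σ x) (σ y) q)) (play-⊏ (delEdge x y e))))
                   (symmetric-removeEdge-pair S)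
                   (Lose-resp-≈ (≈-sym core) (lose f)))
      where
      q : T (edge (removeEdge G x y) (σ x) (σ y))
      q = mirror-edge S moved e
      unfixed : σ x ≢ x ⊎ σ y ≢ y → fixed x ≡ false ⊎ fixed y ≡ false
      unfixed = Data.Sum.map ≢⇒unfixed ≢⇒unfixed
      unfixed-σ : fixed (σ x) ≡ false ⊎ fixed (σ y) ≡ false
      unfixed-σ = Data.Sum.map (≢⇒unfixed ∘ moved-σ) (≢⇒unfixed ∘ moved-σ) moved
      core : removeEdge (removeEdge G x y) (σ x) (σ y) ↾ fixed ≈ G ↾ fixed
      core = ≈-trans (removeEdge-↾-outside {G = removeEdge G x y} unfixed-σ)
                     (removeEdge-↾-outside {G = G} (unfixed moved))

    reply : (m : Move G) → Win (play G m)
    reply (delVertex x p) with σ x ≟ x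
    ... | yes σx≡x =
      mirror-win (rs (play-⊏ (delVertex x p))) (symmetric-removeVertex S σx≡x)
                 (Win-resp-≈ (↾-comm {G = G}) (f (delVertex x (from T-∧ (p , ≡⇒fixed σx≡x)))))
    ... | no σx≢x = reply-moved-vertex p σx≢x
    reply (delEdge x y e) with σ x ≟ x | σ y ≟ y
    ... | yes σx≡x | yes σy≡y =
      mirror-win (rs (play-⊏ (delEdge x y e))) (symmetric-removeEdge S σx≡x σy≡y)
                 (Win-resp-≈ (≈-sym (↾-removeEdge {G = G}))
                             (f (delEdge x y (from T-∧ (e , from T-∧ (≡⇒fixed σx≡x , ≡⇒fixed σy≡y))))))
    ... | no σx≢x | _        = reply-moved-edge e (inj₁ σx≢x)
    ... | yes _   | no σy≢y  = reply-moved-edge e (inj₂ σy≢y)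

  mirror : Symmetric G → G ↾ fixed ▷ G
  mirror {G = G} S = mirror-lose (⊏-wellFounded G) S , mirror-win (⊏-wellFounded G) S

transpose-elim : (R : Fin N → Fin N → Set) → R s t → R t s → (∀ x → x ≢ s → x ≢ t → R x x) →
                 ∀ x → R x (transpose s t x)
transpose-elim {s = s} {t} R Rst Rts Rxx x with x ≟ s
... | yes refl = Rst
... | no x≢s with x ≟ t
...   | yes refl = Rts
...   | no x≢t   = Rxx x x≢s x≢t

transpose-s : (s t : Fin N) → transpose s t s ≡ t
transpose-s s t with s ≟ s
... | yes _   = refl
... | no s≢s  = ⊥-elim (s≢s refl)

transpose-t : (s t : Fin N) → transpose s t t ≡ s
transpose-t s t with t ≟ s
... | yes t≡s = t≡s
... | no _ with t ≟ t
...   | yes _   = refl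
...   | no t≢t  = ⊥-elim (t≢t refl)

transpose-other : x ≢ s → x ≢ t → transpose s t x ≡ x
transpose-other {x = x} {s} {t} x≢s x≢t = transpose-elim (λ y z → y ≢ s → y ≢ t → z ≡ y)
  (λ s≢s _ → ⊥-elim (s≢s refl)) (λ _ t≢t → ⊥-elim (t≢t refl)) (λ _ _ _ _ _ → refl) x x≢s x≢t

transpose-involutive : (s t : Fin N) → ∀ x → transpose s t (transpose s t x) ≡ x
transpose-involutive s t = transpose-elim (λ x y → transpose s t y ≡ x)
  (transpose-t s t) (transpose-s s t) (λ x x≢s x≢t → transpose-other x≢s x≢t)

transpose-preserves : (f : Fin N → Bool) → f s ≡ f t → ∀ x → f (transpose s t x) ≡ f x
transpose-preserves {s = s} {t} f fs≡ft =
  transpose-elim (λ x y → f y ≡ f x) (sym fs≡ft) fs≡ft (λ _ _ _ → refl)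

avoid : Fin N → Fin N → Fin N → Bool
avoid s t x = not (x == s) ∧ not (x == t)

avoid-left : avoid s t s ≡ false
avoid-left {s = s} rewrite ==-refl s = refl

avoid-right : avoid s t t ≡ false
avoid-right {s = s} {t} = trans (cong (not (t == s) ∧_) (cong not (==-refl t))) (∧-zeroʳ _)

transpose-fixed : s ≢ t → ∀ x → (transpose s t x == x) ≡ avoid s t x
transpose-fixed {s = s} {t} s≢t = transpose-elim (λ x y → (y == x) ≡ avoid s t x) at-s at-t at-other
  where
  t≢s : t ≢ s
  t≢s = ≢-sym s≢t
  at-s : (t == s) ≡ avoid s t s
  at-s rewrite ==-refl s = dec-false (t ≟ s) t≢s
  at-t : (s == t) ≡ avoid s t t
  at-t rewrite ==-refl t | dec-false (t ≟ s) t≢s = dec-false (s ≟ t) s≢t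
  at-other : ∀ x → x ≢ s → x ≢ t → (x == x) ≡ avoid s t x
  at-other x x≢s x≢t rewrite dec-false (x ≟ s) x≢s | dec-false (x ≟ t) x≢t = ==-refl x

transpose-mirror : s ≢ t → relabel (transpose s t) G ≈ G → ¬ T (edge G s t) → G ↾ avoid s t ▷ G
transpose-mirror {s = s} {t} {G = G} s≢t invariant no-st =
  ▷-trans (≈⇒▷ (↾-cong (≈-refl {G = G}) (λ x → sym (transpose-fixed s≢t x)))) (mirror S)
  where
  open Mirror (transpose s t) (transpose-involutive s t)
  no-ts : ¬ T (edge G t s)
  no-ts = no-st ∘ subst T (trans (cong₂ (edge G) (sym (transpose-s s t)) (sym (transpose-t s t)))
                                 (edge≈ invariant s t))
  S : Symmetric G
  S = record
    { invariant      = invariant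
    ; no-mirror-edge = transpose-elim (λ x y → y ≢ x → ¬ T (edge G x y))
                         (λ _ → no-st) (λ _ → no-ts) (λ _ _ _ x≢x → ⊥-elim (x≢x refl))
    }

-- Cliques

count-avoid : (P : Fin N → Bool) → s ≢ t → T (P s) → T (P t) →
              count P ≡ 2 + count (λ x → P x ∧ avoid s t x)
count-avoid {s = s} {t} P s≢t Ps Pt = begin
  count P
    ≡⟨ count-remove P Ps ⟩
  suc (count (λ x → P x ∧ not (x == s)))
    ≡⟨ cong suc (count-remove (λ x → P x ∧ not (x == s)) Pt∖s) ⟩
  2 + count (λ x → (P x ∧ not (x == s)) ∧ not (x == t))
    ≡⟨ cong (2 +_) (count-cong (λ x → ∧-assoc (P x) _ _)) ⟩
  2 + count (λ x → P x ∧ avoid s t x) ∎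
  where
  open ≡-Reasoning
  Pt∖s : T (P t ∧ not (t == s))
  Pt∖s = from T-∧ (Pt , from T-not-≡ (dec-false (t ≟ s) (≢-sym s≢t)))

all : Fin N → Bool
all _ = true

count-others : (x : Fin (suc N)) → count (λ z → not (z == x)) ≡ N
count-others {N} x = suc-injective (trans (sym (count-remove {x = x} all tt)) (count-true (suc N)))

count-avoid-all : s ≢ t → count {suc (suc N)} (avoid s t) ≡ N
count-avoid-all {N = N} s≢t =
  suc-injective (suc-injective (trans (sym (count-avoid all s≢t tt tt)) (count-true (2 + N))))

clique : (Fin N → Bool) → Graph N
clique P = complete _ ↾ P

clique-removeVertex : removeVertex (clique P) x ≈ clique (λ z → P z ∧ not (z == x))
clique-removeVertex {P = P} = ↾-↾ {G = complete _} {P = P}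

clique-edge : ∀ {a b} → T (edge (clique P) a b) → a ≢ b × T (P a) × T (P b)
clique-edge {P = P} {a} {b} e with to (T-∧ {not (a == b)}) e
... | a≠b , Pab = (λ a≡b → true≢false (trans (sym (dec-true (a ≟ b) a≡b)) (to T-not-≡ a≠b)))
                , to T-∧ Pab

clique-has-edge : (P : Fin N → Bool) {r : ℕ} → count P ≡ 2 + r →
                  ∃[ a ] ∃[ b ] T (edge (clique P) a b)
clique-has-edge P cnt with count-witness cnt
... | a , Pa with count-witness {P = λ x → P x ∧ not (x == a)}
                                (suc-injective (trans (sym (count-remove P Pa)) cnt))
...   | b , Pb∖a with to (T-∧ {P b}) Pb∖a
...     | Pb , b≠a = a , b , from T-∧ (subst (T ∘ not) (==-sym b a) b≠a , from T-∧ (Pa , Pb))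

clique-transpose : P s ≡ P t → relabel (transpose s t) (clique P) ≈ clique P
clique-transpose {P = P} {s = s} {t} Ps≡Pt = ↾-cong relabel-complete (transpose-preserves P Ps≡Pt)
  where open Mirror (transpose s t) (transpose-involutive s t) using (relabel-complete)

clique-removeEdge : s ≢ t → T (P s) → T (P t) →
                    clique (λ x → P x ∧ avoid s t x) ▷ removeEdge (clique P) s t
clique-removeEdge {s = s} {t} {P = P} s≢t Ps Pt =
  ▷-trans (≈⇒▷ core)
          (transpose-mirror s≢t invariant (removeEdge-removes {G = clique P} {u = s} {v = t}))
  where
  open Mirror (transpose s t) (transpose-involutive s t) using (relabel-removeEdge)
  open ≈-Reasoning
  invariant : relabel (transpose s t) (removeEdge (clique P) s t) ≈ removeEdge (clique P) s t
  invariant = begin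
    relabel (transpose s t) (removeEdge (clique P) s t)
      ≈⟨ relabel-removeEdge {G = clique P} ⟩
    removeEdge (relabel (transpose s t) (clique P)) (transpose s t s) (transpose s t t)
      ≈⟨ removeEdge-cong (clique-transpose (trans (to T-≡ Ps) (sym (to T-≡ Pt))))
                         (transpose-s s t) (transpose-t s t) ⟩
    removeEdge (clique P) t s
      ≈⟨ removeEdge-sym {G = clique P} ⟩
    removeEdge (clique P) s t ∎
  core : clique (λ x → P x ∧ avoid s t x) ≈ removeEdge (clique P) s t ↾ avoid s t
  core = begin
    clique (λ x → P x ∧ avoid s t x)
      ≈⟨ ≈-sym (↾-↾ {G = complete _} {P = P} {Q = avoid s t}) ⟩
    clique P ↾ avoid s t
      ≈⟨ ≈-sym (removeEdge-↾-outside {G = clique P} (inj₁ (avoid-left {s = s} {t}))) ⟩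
    removeEdge (clique P) s t ↾ avoid s t ∎

Mod3 : ℕ → Set
Mod3 r = (r % 3 ≡ 0 × suc r % 3 ≡ 1 × suc (suc r) % 3 ≡ 2)
       ⊎ (r % 3 ≡ 1 × suc r % 3 ≡ 2 × suc (suc r) % 3 ≡ 0)
       ⊎ (r % 3 ≡ 2 × suc r % 3 ≡ 0 × suc (suc r) % 3 ≡ 1)

-- The last clause typechecks because (3 + r) % 3 reduces to r % 3.
mod3 : ∀ r → Mod3 r
mod3 0 = inj₁ (refl , refl , refl)
mod3 1 = inj₂ (inj₁ (refl , refl , refl))
mod3 2 = inj₂ (inj₂ (refl , refl , refl))
mod3 (suc (suc (suc r))) = mod3 r

clique-step : ∀ r (P : Fin N → Bool) → count P ≡ 2 + r →
  (∀ Q → count Q ≡ suc r → Outcome (suc r % 3) (clique Q)) →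
  (∀ Q → count Q ≡ r → Outcome (r % 3) (clique Q)) →
  Outcome (suc (suc r) % 3) (clique P)
clique-step r P cnt outcome₁ outcome₀ = by-residue (mod3 r) (clique-has-edge P cnt)
  where
  C : Graph _
  C = clique P

  after-vertex : T (P x) → Outcome (suc r % 3) (removeVertex C x)
  after-vertex {x} p = ▷-Outcome (≈⇒▷ (≈-sym (clique-removeVertex {P = P} {x = x}))) _
    (outcome₁ _ (suc-injective (trans (sym (count-remove P p)) cnt)))

  after-edge : ∀ {a b} → T (edge C a b) → Outcome (r % 3) (removeEdge C a b)
  after-edge e with clique-edge {P = P} e
  ... | a≢b , Pa , Pb = ▷-Outcome (clique-removeEdge {P = P} a≢b Pa Pb) _
    (outcome₀ _ (suc-injective (suc-injective (trans (sym (count-avoid P a≢b Pa Pb)) cnt))))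

  by-residue : Mod3 r → ∃[ a ] ∃[ b ] T (edge C a b) → Outcome (suc (suc r) % 3) C
  by-residue (inj₁ (r≡0 , _ , 2+r≡2)) (a , b , ab) =
    Outcome-≡ C (sym 2+r≡2) (win (delEdge a b ab) (Outcome-≡ _ r≡0 (after-edge ab)))
  by-residue (inj₂ (inj₁ (r≡1 , 1+r≡2 , 2+r≡0))) _ =
    Outcome-≡ C (sym 2+r≡0) (lose λ where
      (delVertex x p) → Outcome-≡ _ 1+r≡2 (after-vertex p)
      (delEdge x y e) → Outcome-≡ _ r≡1 (after-edge e))
  by-residue (inj₂ (inj₂ (_ , 1+r≡0 , 2+r≡1))) (a , b , ab) with clique-edge {P = P} ab
  ... | _ , Pa , _ =
    Outcome-≡ C (sym 2+r≡1) (win (delVertex a Pa) (Outcome-≡ _ 1+r≡0 (after-vertex Pa)))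

clique-outcome : ∀ r (P : Fin N → Bool) → count P ≡ r → Outcome (r % 3) (clique P)
clique-outcome zero P empty = lose λ where
  (delVertex x p) → ⊥-elim (count-zero {P = P} empty p)
  (delEdge a b e) → ⊥-elim (count-zero {P = P} empty (proj₁ (proj₂ (clique-edge {P = P} {a} {b} e))))
clique-outcome (suc zero) P single with count-witness single
... | x , p = win (delVertex x p)
  (Lose-resp-≈ (≈-sym (clique-removeVertex {P = P} {x = x}))
               (clique-outcome 0 _ (suc-injective (trans (sym (count-remove P p)) single))))
clique-outcome (suc (suc r)) P cnt = clique-step r P cnt (clique-outcome (suc r)) (clique-outcome r)

-- The graphs K n i

<ᵇ-fromℕ : (x : Fin (suc n)) → (toℕ x <ᵇ n) ≡ not (x == fromℕ n)
<ᵇ-fromℕ {zero}  zero    = refl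
<ᵇ-fromℕ {suc n} zero    = refl
<ᵇ-fromℕ {suc n} (suc x) = <ᵇ-fromℕ x

<ᵇ-toℕ : ∀ {N} (x u : Fin N) → (toℕ x <ᵇ toℕ u) ≡ (toℕ x <ᵇ suc (toℕ u)) ∧ not (x == u)
<ᵇ-toℕ zero    zero    = refl
<ᵇ-toℕ zero    (suc u) = refl
<ᵇ-toℕ (suc x) zero    = refl
<ᵇ-toℕ (suc x) (suc u) = <ᵇ-toℕ x u

≤⇒≮ᵇ : ∀ {m k} → k ≤ m → (m <ᵇ k) ≡ false
≤⇒≮ᵇ z≤n       = refl
≤⇒≮ᵇ (s≤s k≤m) = ≤⇒≮ᵇ k≤m

-- apex n is the vertex v_i of K n i, and clique-vertex m<n is its vertex u_{m+1}.
apex : ∀ n → Fin (suc n)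
apex = fromℕ

clique-vertex : ∀ {m} → m < n → Fin (suc n)
clique-vertex m<n = fromℕ< (m<n⇒m<1+n m<n)

toℕ-clique-vertex : ∀ {m} (m<n : m < n) → toℕ (clique-vertex m<n) ≡ m
toℕ-clique-vertex m<n = toℕ-fromℕ< (m<n⇒m<1+n m<n)

toℕ-≢ : ∀ {N} {a b : Fin N} {m k} → toℕ a ≡ m → toℕ b ≡ k → m ≢ k → a ≢ b
toℕ-≢ ta≡m tb≡k m≢k a≡b = m≢k (trans (sym ta≡m) (trans (cong toℕ a≡b) tb≡k))

clique-vertex≢apex : ∀ {m} (m<n : m < n) → clique-vertex m<n ≢ apex n
clique-vertex≢apex {n} m<n = toℕ-≢ (toℕ-clique-vertex m<n) (toℕ-fromℕ n) (<⇒≢ m<n)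

K-complete : K n n ≈ clique all
K-complete {n} = mk≈ (λ _ → refl) edges
  where
  edges : ∀ a b → edge (K n n) a b ≡ not (a == b) ∧ true
  edges a b rewrite <ᵇ-fromℕ a | <ᵇ-fromℕ b with a ≟ apex n
  ... | yes refl rewrite ∧-zeroʳ (b == apex n) | ∨-identityʳ (not (b == apex n))
                       | ∧-identityʳ (not (apex n == b)) = cong not (==-sym b (apex n))
  ... | no a≢apex with b ≟ apex n
  ...   | yes refl rewrite dec-false (a ≟ apex n) a≢apex = refl
  ...   | no _     rewrite ∨-identityʳ (not (a == b)) = sym (∧-identityʳ (not (a == b)))

K-removeEdge : (u : Fin (suc n)) → toℕ u ≡ i → i < n → K n i ≈ removeEdge (K n (suc i)) (apex n) u
K-removeEdge {n} u refl u<n = mk≈ (λ _ → refl) edges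
  where
  apex≢u : apex n ≢ u
  apex≢u = toℕ-≢ (toℕ-fromℕ n) refl (≢-sym (<⇒≢ u<n))
  apex-far : (toℕ (apex n) <ᵇ suc (toℕ u)) ≡ false
  apex-far rewrite toℕ-fromℕ n = ≤⇒≮ᵇ u<n
  edges : ∀ a b → edge (K n (toℕ u)) a b ≡ edge (removeEdge (K n (suc (toℕ u))) (apex n) u) a b
  edges a b rewrite <ᵇ-toℕ a u | <ᵇ-toℕ b u | <ᵇ-fromℕ a | <ᵇ-fromℕ b with a ≟ apex n
  ... | yes refl rewrite apex-far | dec-false (apex n ≟ u) apex≢u
                       | ∧-zeroʳ (b == apex n)
                       | ∨-identityʳ ((toℕ b <ᵇ suc (toℕ u)) ∧ not (b == u))
                       | ∨-identityʳ (toℕ b <ᵇ suc (toℕ u))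
                       | ∨-identityʳ (b == u) = refl
  ... | no _ with b ≟ apex n
  ...   | yes refl rewrite ∧-identityʳ (a == u) = refl
  ...   | no _     rewrite ∧-zeroʳ (a == u) = sym (∧-identityʳ _)

K-i-i-outcome : ∀ i → Outcome (suc i % 3) (K i i)
K-i-i-outcome i =
  ▷-Outcome (≈⇒▷ (≈-sym K-complete)) _ (clique-outcome (suc i) all (count-true (suc i)))

K-1+i-i-outcome : ∀ i → Outcome (i % 3) (K (suc i) i)
K-1+i-i-outcome i =
  ▷-Outcome (▷-trans (clique-removeEdge {P = all} apex≢uᵢ tt tt) (≈⇒▷ (≈-sym K≈))) _
            (clique-outcome i _ (count-avoid-all apex≢uᵢ))
  where
  uᵢ : Fin (2 + i)
  uᵢ = clique-vertex (n<1+n i)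
  apex≢uᵢ : apex (suc i) ≢ uᵢ
  apex≢uᵢ = ≢-sym (clique-vertex≢apex (n<1+n i))
  K≈ : K (suc i) i ≈ removeEdge (clique all) (apex (suc i)) uᵢ
  K≈ = ≈-trans (K-removeEdge uᵢ (toℕ-clique-vertex (n<1+n i)) (n<1+n i))
               (removeEdge-cong K-complete refl refl)

module K-2+i-i (i : ℕ) where

  i<2+i : i < 2 + i
  i<2+i = m<n⇒m<1+n (n<1+n i)

  vᵢ u₀ u₁ : Fin (3 + i)
  vᵢ = apex (2 + i)
  u₀ = clique-vertex i<2+i
  u₁ = clique-vertex (n<1+n (suc i))

  u₀≢u₁ : u₀ ≢ u₁
  u₀≢u₁ = toℕ-≢ (toℕ-clique-vertex i<2+i) (toℕ-clique-vertex (n<1+n (suc i))) (<⇒≢ (n<1+n i))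

  u₀≢vᵢ : u₀ ≢ vᵢ
  u₀≢vᵢ = clique-vertex≢apex i<2+i

  u₁≢vᵢ : u₁ ≢ vᵢ
  u₁≢vᵢ = clique-vertex≢apex (n<1+n (suc i))

  C G₂ G₃ : Graph (3 + i)
  C  = clique all
  G₂ = removeEdge (removeEdge C vᵢ u₁) vᵢ u₀
  G₃ = removeEdge G₂ u₀ u₁

  K≈G₂ : K (2 + i) i ≈ G₂
  K≈G₂ = ≈-trans (K-removeEdge u₀ (toℕ-clique-vertex i<2+i) i<2+i)
           (removeEdge-cong (≈-trans (K-removeEdge u₁ (toℕ-clique-vertex (n<1+n (suc i))) (n<1+n (suc i)))
                                     (removeEdge-cong K-complete refl refl)) refl refl)

  open ≈-Reasoning

  removeVertex-u₁ : removeVertex G₂ u₁ ≈ removeEdge (clique (λ z → not (z == u₁))) vᵢ u₀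
  removeVertex-u₁ = begin
    removeVertex G₂ u₁
      ≈⟨ ↾-removeEdge {G = removeEdge C vᵢ u₁} ⟩
    removeEdge (removeVertex (removeEdge C vᵢ u₁) u₁) vᵢ u₀
      ≈⟨ removeEdge-cong (removeEdge-↾-outside {G = C} (inj₂ (cong not (==-refl u₁)))) refl refl ⟩
    removeEdge (removeVertex C u₁) vᵢ u₀
      ≈⟨ removeEdge-cong (clique-removeVertex {P = all} {x = u₁}) refl refl ⟩
    removeEdge (clique (λ z → not (z == u₁))) vᵢ u₀ ∎

  removeVertex-vᵢ : removeVertex G₂ vᵢ ≈ clique (λ z → not (z == vᵢ))
  removeVertex-vᵢ = begin
    removeVertex G₂ vᵢ
      ≈⟨ removeEdge-↾-outside {G = removeEdge C vᵢ u₁} (inj₁ (cong not (==-refl vᵢ))) ⟩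
    removeVertex (removeEdge C vᵢ u₁) vᵢ
      ≈⟨ removeEdge-↾-outside {G = C} (inj₁ (cong not (==-refl vᵢ))) ⟩
    removeVertex C vᵢ
      ≈⟨ clique-removeVertex {P = all} {x = vᵢ} ⟩
    clique (λ z → not (z == vᵢ)) ∎

  G₃-invariant : relabel (transpose u₀ u₁) G₃ ≈ G₃
  G₃-invariant = begin
    relabel σ G₃
      ≈⟨ relabel-removeEdge {G = G₂} ⟩
    removeEdge (relabel σ G₂) (σ u₀) (σ u₁)
      ≈⟨ removeEdge-cong (≈-trans (relabel-removeEdge {G = removeEdge C vᵢ u₁})
                           (removeEdge-cong (≈-trans (relabel-removeEdge {G = C})
                                                     (removeEdge-cong (clique-transpose refl) σvᵢ (transpose-t u₀ u₁)))
                                            σvᵢ (transpose-s u₀ u₁)))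
                         (transpose-s u₀ u₁) (transpose-t u₀ u₁) ⟩
    removeEdge (removeEdge (removeEdge C vᵢ u₀) vᵢ u₁) u₁ u₀
      ≈⟨ removeEdge-sym {G = removeEdge (removeEdge C vᵢ u₀) vᵢ u₁} ⟩
    removeEdge (removeEdge (removeEdge C vᵢ u₀) vᵢ u₁) u₀ u₁
      ≈⟨ removeEdge-cong (removeEdge-comm {G = C}) refl refl ⟩
    G₃ ∎
    where
    σ : Fin (3 + i) → Fin (3 + i)
    σ = transpose u₀ u₁
    open Mirror σ (transpose-involutive u₀ u₁) using (relabel-removeEdge)
    σvᵢ : σ vᵢ ≡ vᵢ
    σvᵢ = transpose-other (≢-sym u₀≢vᵢ) (≢-sym u₁≢vᵢ)

  G₃-core : G₃ ↾ avoid u₀ u₁ ≈ clique (avoid u₀ u₁)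
  G₃-core = begin
    G₃ ↾ avoid u₀ u₁
      ≈⟨ removeEdge-↾-outside {G = G₂} (inj₁ (avoid-left {s = u₀} {u₁})) ⟩
    G₂ ↾ avoid u₀ u₁
      ≈⟨ removeEdge-↾-outside {G = removeEdge C vᵢ u₁} (inj₂ (avoid-left {s = u₀} {u₁})) ⟩
    removeEdge C vᵢ u₁ ↾ avoid u₀ u₁
      ≈⟨ removeEdge-↾-outside {G = C} (inj₂ (avoid-right {s = u₀} {u₁})) ⟩
    C ↾ avoid u₀ u₁
      ≈⟨ ↾-↾ {G = complete _} {P = all} {Q = avoid u₀ u₁} ⟩
    clique (avoid u₀ u₁) ∎

  lose-after-u₁ : i % 3 ≡ 0 → Lose (removeVertex G₂ u₁)
  lose-after-u₁ i≡0 = Outcome-≡ (removeVertex G₂ u₁) i≡0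
    (▷-Outcome (▷-trans (clique-removeEdge {P = ¬u₁} vᵢ≢u₀ ¬u₁-vᵢ ¬u₁-u₀)
                        (≈⇒▷ (≈-sym removeVertex-u₁))) _
               (clique-outcome i _ (suc-injective (suc-injective
                  (trans (sym (count-avoid ¬u₁ vᵢ≢u₀ ¬u₁-vᵢ ¬u₁-u₀)) (count-others u₁))))))
    where
    ¬u₁ : Fin (3 + i) → Bool
    ¬u₁ z = not (z == u₁)
    vᵢ≢u₀ : vᵢ ≢ u₀
    vᵢ≢u₀ = ≢-sym u₀≢vᵢ
    ¬u₁-vᵢ : T (¬u₁ vᵢ)
    ¬u₁-vᵢ = from T-not-≡ (dec-false (vᵢ ≟ u₁) (≢-sym u₁≢vᵢ))
    ¬u₁-u₀ : T (¬u₁ u₀)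
    ¬u₁-u₀ = from T-not-≡ (dec-false (u₀ ≟ u₁) u₀≢u₁)

  lose-after-vᵢ : (2 + i) % 3 ≡ 0 → Lose (removeVertex G₂ vᵢ)
  lose-after-vᵢ 2+i≡0 = Outcome-≡ (removeVertex G₂ vᵢ) 2+i≡0
    (▷-Outcome (≈⇒▷ (≈-sym removeVertex-vᵢ)) _ (clique-outcome (2 + i) _ (count-others vᵢ)))

  lose-after-u₀u₁ : suc i % 3 ≡ 0 → Lose G₃
  lose-after-u₀u₁ 1+i≡0 = Outcome-≡ G₃ 1+i≡0
    (▷-Outcome (▷-trans (≈⇒▷ (≈-sym G₃-core))
                        (transpose-mirror u₀≢u₁ G₃-invariant
                                          (removeEdge-removes {G = G₂} {u = u₀} {v = u₁}))) _
               (clique-outcome (suc i) _ (count-avoid-all u₀≢u₁)))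

  u₀u₁ : T (edge (K (2 + i) i) u₀ u₁)
  u₀u₁ = subst T (sym (edge≈ K≈G₂ u₀ u₁)) G₂-u₀u₁
    where
    G₂-u₀u₁ : T (edge G₂ u₀ u₁)
    G₂-u₀u₁ rewrite dec-false (u₀ ≟ u₁) u₀≢u₁ | dec-false (u₀ ≟ vᵢ) u₀≢vᵢ
                  | dec-false (u₁ ≟ vᵢ) u₁≢vᵢ | ==-refl u₀ = tt

  first-player-wins : Win (K (2 + i) i)
  first-player-wins with mod3 i
  ... | inj₁ (i≡0 , _ , _) =
    win (delVertex u₁ tt)
        (Lose-resp-≈ (≈-sym (removeVertex-cong K≈G₂ refl)) (lose-after-u₁ i≡0))
  ... | inj₂ (inj₁ (_ , _ , 2+i≡0)) =
    win (delVertex vᵢ tt)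
        (Lose-resp-≈ (≈-sym (removeVertex-cong K≈G₂ refl)) (lose-after-vᵢ 2+i≡0))
  ... | inj₂ (inj₂ (_ , 1+i≡0 , _)) =
    win (delEdge u₀ u₁ u₀u₁)
        (Lose-resp-≈ (≈-sym (removeEdge-cong K≈G₂ refl refl)) (lose-after-u₀u₁ 1+i≡0))

LosingPair : ℕ → ℕ → Set
LosingPair a b = (a ≡ 2 × b ≡ 2) ⊎ (a ≡ 0 × b ≡ 1)

losingPair? : ∀ a b → Dec (LosingPair a b)
losingPair? a b = (a ℕ.≟ 2 ×-dec b ℕ.≟ 2) ⊎-dec (a ℕ.≟ 0 ×-dec b ℕ.≟ 1)

verdict : ∀ {N} {a b} (G : Graph N) k → does (losingPair? a b) ≡ (k ≡ᵇ 0) → Outcome k G →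
          (LosingPair a b → Lose G) × (¬ LosingPair a b → Win G)
verdict {a = a} {b} G zero    eq l =
  (λ _ → l) , λ ¬lp → ⊥-elim (true≢false (trans (sym eq) (dec-false (losingPair? a b) ¬lp)))
verdict {a = a} {b} G (suc k) eq w =
  (λ lp → ⊥-elim (true≢false (trans (sym (dec-true (losingPair? a b) lp)) eq))) , λ _ → w

residue-verdicts : ∀ i → does (losingPair? (i % 3) (i % 3)) ≡ (suc i % 3 ≡ᵇ 0)
                       × does (losingPair? (i % 3) (suc i % 3)) ≡ (i % 3 ≡ᵇ 0)
                       × does (losingPair? (i % 3) (suc (suc i) % 3)) ≡ false
residue-verdicts i with mod3 i
... | inj₁ (p , q , r)        rewrite p | q | r = refl , refl , refl
... | inj₂ (inj₁ (p , q , _)) rewrite p | q     = refl , refl , refl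
... | inj₂ (inj₂ (p , q , r)) rewrite p | q | r = refl , refl , refl

lemma4p2 : (i n : ℕ) → (n ≡ i ⊎ n ≡ suc i ⊎ n ≡ 2 + i) →
    (((i % 3 ≡ 2 × n % 3 ≡ 2) ⊎ (i % 3 ≡ 0 × n % 3 ≡ 1)) → Lose (K n i))
    × (¬ ((i % 3 ≡ 2 × n % 3 ≡ 2) ⊎ (i % 3 ≡ 0 × n % 3 ≡ 1)) → Win (K n i))
lemma4p2 i .i (inj₁ refl) =
  verdict (K i i) (suc i % 3) (proj₁ (residue-verdicts i)) (K-i-i-outcome i)
lemma4p2 i .(suc i) (inj₂ (inj₁ refl)) =
  verdict (K (suc i) i) (i % 3) (proj₁ (proj₂ (residue-verdicts i))) (K-1+i-i-outcome i)
lemma4p2 i .(suc (suc i)) (inj₂ (inj₂ refl)) =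
  verdict (K (2 + i) i) 1 (proj₂ (proj₂ (residue-verdicts i))) (K-2+i-i.first-player-wins i)
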